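{- Let $w$ be a finite word with $|\mathrm{Alph}(w)|\ge 2$. Then $|w|=L_w+H_w+|\mathrm{Alph}(w)|-2$ if and only if $w$ has exactly one left special factor of length $i$ for every integer $0\le i<L_w$, and every non-empty left special factor of $w$ has left-valence $2$.
   Context: Words are finite sequences of letters; $|w|$ is the length and $\mathrm{Alph}(w)$ the set of letters of $w$. A factor is a contiguous subword (including the empty word). A factor $u$ of $w$ has left-valence $j$ if $xu$ is a factor of $w$ for exactly $j$ distinct letters $x$; $u$ is left special if its left-valence is at least $2$. $L_w$ is the smallest positive integer $\ell$ such that $w$ has no left special factor of length $\ell$; $H_w$ is the length of the shortest prefix of $w$ occurring exactly once in $w$. -}

module Defs where

open import Level using (Level)
open import Data.Nat using (ℕ; zero; suc; _+_; _≤_; _<_)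
open import Data.List using (List; []; _∷_; _++_; length; deduplicate)
open import Data.List.Membership.Propositional using (_∈_)
open import Data.List.Relation.Unary.Unique.Propositional using (Unique)
open import Data.Product using (Σ; ∃; ∃-syntax; _×_; _,_)
open import Relation.Binary.PropositionalEquality using (_≡_)
open import Relation.Binary.Definitions using (DecidableEquality)
open import Relation.Nullary using (¬_)
open import Function.Bundles using (_⇔_)

module _ {a : Level} {A : Set a} where

  Factor : List A → List A → Set a
  Factor u w = ∃[ p ] ∃[ s ] (w ≡ p ++ u ++ s)

  OccursAt : List A → List A → ℕ → Set a
  OccursAt u w i = ∃[ p ] ∃[ s ] ((w ≡ p ++ u ++ s) × length p ≡ i)

  OccursOnce : List A → List A → Set a
  OccursOnce u w = ∃[ i ] (OccursAt u w i × (∀ j → OccursAt u w j → j ≡ i))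

  Prefix : List A → List A → Set a
  Prefix u w = ∃[ s ] (w ≡ u ++ s)

  LeftValence : List A → List A → ℕ → Set a
  LeftValence w u j =
    Factor u w ×
    ∃[ xs ] (Unique xs × (∀ x → (x ∈ xs) ⇔ Factor (x ∷ u) w) × length xs ≡ j)

  LeftSpecial : List A → List A → Set a
  LeftSpecial w u = ∃[ j ] (LeftValence w u j × 2 ≤ j)

  IsL : List A → ℕ → Set a
  IsL w L =
    1 ≤ L ×
    (∀ u → LeftSpecial w u → ¬ (length u ≡ L)) ×
    (∀ ℓ → 1 ≤ ℓ → ℓ < L → ∃[ u ] (LeftSpecial w u × length u ≡ ℓ))

  IsH : List A → ℕ → Set a
  IsH w H =
    ∃[ u ] (Prefix u w × length u ≡ H × OccursOnce u w) ×
    (∀ v → Prefix v w → OccursOnce v w → H ≤ length v)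

  alphSize : DecidableEquality A → List A → ℕ
  alphSize _≟_ w = length (deduplicate _≟_ w)

  UniqueLSOfLength : List A → ℕ → Set a
  UniqueLSOfLength w i =
    ∃[ u ] (LeftSpecial w u × length u ≡ i ×
            (∀ v → LeftSpecial w v → length v ≡ i → v ≡ u))

module Submission where

-- Let F ℓ be the number of distinct factors of
-- length ℓ and val u the left-valence of a factor u.  Every factor of length
-- ℓ+1 is x·u for a unique factor u of length ℓ, so F (ℓ+1) = Σ_u val u.
-- A factor of valence 0 ("dead end") is a prefix occurring once, so there is
-- no dead end of length ℓ < H and exactly one (the prefix) of length
-- H ≤ ℓ ≤ |w|.  Writing excess ℓ = Σ_u (val u - 1) this gives the balance
--   F (ℓ+1) + deadEnds ℓ = F ℓ + excess ℓ,
-- which telescopes (F 0 = F |w| = 1) to  |w| - H = Σ_{ℓ<|w|} excess ℓ.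
-- Here excess 0 = d - 1, excess ℓ = 0 for ℓ ≥ L, and excess ℓ ≥ 1 for
-- 1 ≤ ℓ < L.  Hence |w| = L + H + d - 2 iff excess ℓ = 1 for all 1 ≤ ℓ < L,
-- and excess ℓ = 1 says exactly that the left special factor of length ℓ is
-- unique and of valence 2.

open import Defs
open import Level using (Level)
open import Data.Nat using (ℕ; zero; suc; _+_; _∸_; _≤_; _<_; z≤n; s≤s; s≤s⁻¹; _≤?_; _<?_)
  renaming (_≟_ to _≟ℕ_)
open import Data.Nat.Properties hiding (_≟_)
open import Data.List using (List; []; _∷_; _++_; _∷ʳ_; length; filter; map; deduplicate; initLast; _∷ʳ′_)
open import Data.List.Properties using (filter-all; length-++; length-++-sucʳ; length-map; ≡-dec; ++-assoc; ++-identityʳ; ∷-injective)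
open import Data.List.Membership.Propositional using (_∈_)
open import Data.List.Membership.Propositional.Properties
  using (∈-∃++; ∈-map⁺; ∈-map⁻; ∈-++⁺ˡ; ∈-++⁺ʳ; ∈-++⁻; ∈-filter⁺; ∈-filter⁻; ∈-deduplicate⁺; ∈-deduplicate⁻)
import Data.List.Membership.DecPropositional as DecMembership
open import Data.List.Relation.Binary.Subset.Propositional using (_⊆_)
open import Data.List.Relation.Unary.Unique.Propositional using (Unique)
import Data.List.Relation.Unary.Unique.Propositional.Properties as Unique
import Data.List.Relation.Unary.Unique.DecPropositional.Properties as UniqueDec
open import Data.List.Relation.Unary.AllPairs using ([]; _∷_)
open import Data.List.Relation.Unary.All as All using (All; []; _∷_)
open import Data.List.Relation.Unary.Any using (here; there)
open import Data.Product using (∃; ∃-syntax; _×_; _,_; proj₁; proj₂)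
open import Data.Sum using (inj₁; inj₂)
open import Data.Empty using (⊥; ⊥-elim)
open import Relation.Binary.PropositionalEquality
open import Relation.Binary.Definitions using (DecidableEquality)
open import Relation.Nullary using (¬_; Dec; yes; no; does)
open import Data.Bool using (if_then_else_)
open import Relation.Nullary.Decidable using (map′)
open import Function using (_∘′_)
open import Function.Bundles using (_⇔_; mk⇔; Equivalence)
open import Function.Properties.Equivalence using () renaming (trans to ⇔-trans)
open import Data.Nat.Solver using (module +-*-Solver)
open +-*-Solver using (solve; _:+_; _:=_; con)
open import Algebra.Properties.CommutativeSemigroup +-commutativeSemigroup
  using (interchange; x∙yz≈y∙xz; x∙yz≈xz∙y; xy∙z≈xz∙y)

module _ {b : Level} {B : Set b} where

  sumOver : (B → ℕ) → List B → ℕ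
  sumOver h [] = 0
  sumOver h (x ∷ X) = h x + sumOver h X

  sumOver-cong : ∀ g h (X : List B) → (∀ {u} → u ∈ X → g u ≡ h u) → sumOver g X ≡ sumOver h X
  sumOver-cong g h [] _ = refl
  sumOver-cong g h (x ∷ X) eq = cong₂ _+_ (eq (here refl)) (sumOver-cong g h X (eq ∘′ there))

  sumOver-+ : ∀ g h (X : List B) → sumOver (λ u → g u + h u) X ≡ sumOver g X + sumOver h X
  sumOver-+ g h [] = refl
  sumOver-+ g h (x ∷ X) = trans (cong (g x + h x +_) (sumOver-+ g h X)) (interchange (g x) (h x) _ _)

  sumOver-zero : ∀ h (X : List B) → (∀ {u} → u ∈ X → h u ≡ 0) → sumOver h X ≡ 0
  sumOver-zero h X zero-on-X = trans (sumOver-cong h (λ _ → 0) X zero-on-X) (sumOver-0 X)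
    where
    sumOver-0 : ∀ (X : List B) → sumOver (λ _ → 0) X ≡ 0
    sumOver-0 [] = refl
    sumOver-0 (_ ∷ X) = sumOver-0 X

  sumOver-single : ∀ h {X : List B} {v} → Unique X → v ∈ X →
    (∀ {u} → u ∈ X → u ≢ v → h u ≡ 0) → sumOver h X ≡ h v
  sumOver-single h {x ∷ X} (x∉X ∷ _) (here refl) zero-off-v =
    trans (cong (h x +_) (sumOver-zero h X (λ u∈X → zero-off-v (there u∈X) (λ { refl → All.lookup x∉X u∈X refl }))))
          (+-identityʳ (h x))
  sumOver-single h {x ∷ X} (x∉X ∷ X!) (there v∈X) zero-off-v =
    cong₂ _+_ (zero-off-v (here refl) (λ { refl → All.lookup x∉X v∈X refl }))
              (sumOver-single h X! v∈X (λ u∈X → zero-off-v (there u∈X)))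

  sumOver-≥-member : ∀ h {X : List B} {u} → u ∈ X → h u ≤ sumOver h X
  sumOver-≥-member h (here refl) = m≤m+n _ _
  sumOver-≥-member h (there u∈X) = ≤-trans (sumOver-≥-member h u∈X) (m≤n+m _ _)

  sumOver-≥-pair : ∀ h {X : List B} {u v} → Unique X → u ∈ X → v ∈ X → u ≢ v →
    h u + h v ≤ sumOver h X
  sumOver-≥-pair h _ (here refl) (here refl) u≢v = ⊥-elim (u≢v refl)
  sumOver-≥-pair h _ (here refl) (there v∈X) _ = +-monoʳ-≤ _ (sumOver-≥-member h v∈X)
  sumOver-≥-pair h {_ ∷ X} {u = u} {v} _ (there u∈X) (here refl) _ =
    subst (_≤ h v + sumOver h X) (+-comm (h v) (h u)) (+-monoʳ-≤ _ (sumOver-≥-member h u∈X))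
  sumOver-≥-pair h (_ ∷ X!) (there u∈X) (there v∈X) u≢v =
    ≤-trans (sumOver-≥-pair h X! u∈X v∈X u≢v) (m≤n+m _ _)

  member⇒length≥1 : ∀ {x} {xs : List B} → x ∈ xs → 1 ≤ length xs
  member⇒length≥1 {xs = _ ∷ _} _ = s≤s z≤n

  length≥1⇒member : ∀ {xs : List B} → 1 ≤ length xs → ∃[ x ] (x ∈ xs)
  length≥1⇒member {x ∷ _} _ = x , here refl

  no-member⇒length≡0 : ∀ (xs : List B) → (∀ {x} → x ∈ xs → ⊥) → length xs ≡ 0
  no-member⇒length≡0 [] _ = refl
  no-member⇒length≡0 (x ∷ xs) no-member = ⊥-elim (no-member (here refl))

  unique-⊆⇒length-≤ : ∀ {xs ys : List B} → Unique xs → xs ⊆ ys → length xs ≤ length ys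
  unique-⊆⇒length-≤ {[]} _ _ = z≤n
  unique-⊆⇒length-≤ {x ∷ xs} (x∉xs ∷ xs!) xs⊆ys with ∈-∃++ (xs⊆ys (here refl))
  ... | ys₁ , ys₂ , refl =
    subst (suc (length xs) ≤_) (sym (length-++-sucʳ ys₁ x ys₂))
      (s≤s (unique-⊆⇒length-≤ xs! (λ z∈xs → remove ys₁ (xs⊆ys (there z∈xs))
                                                (λ { refl → All.lookup x∉xs z∈xs refl }))))
    where
    remove : ∀ (ys₁ : List B) {z ys₂} → z ∈ ys₁ ++ x ∷ ys₂ → z ≢ x → z ∈ ys₁ ++ ys₂
    remove [] (here refl) z≢x = ⊥-elim (z≢x refl)
    remove [] (there z∈) _ = z∈
    remove (y ∷ ys₁) (here refl) _ = here refl
    remove (y ∷ ys₁) (there z∈) z≢x = there (remove ys₁ z∈ z≢x)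

  unique-constant⇒length≡1 : ∀ {xs : List B} {v} → Unique xs → v ∈ xs →
    (∀ {u} → u ∈ xs → u ≡ v) → length xs ≡ 1
  unique-constant⇒length≡1 {x ∷ []} _ _ _ = refl
  unique-constant⇒length≡1 {x ∷ y ∷ xs} ((x≢y ∷ _) ∷ _) _ all-v =
    ⊥-elim (x≢y (trans (all-v (here refl)) (sym (all-v (there (here refl))))))

  unique-constant⇒length≤1 : ∀ {xs : List B} → Unique xs → (∀ {u v} → u ∈ xs → v ∈ xs → u ≡ v) →
    length xs ≤ 1
  unique-constant⇒length≤1 {[]} _ _ = z≤n
  unique-constant⇒length≤1 {x ∷ xs} xs! all-eq =
    ≤-reflexive (unique-constant⇒length≡1 xs! (here refl) (λ u∈ → all-eq u∈ (here refl)))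

module _ {b p : Level} {B : Set b} {P : B → Set p} (P? : ∀ x → Dec (P x)) where

  count : List B → ℕ
  count X = length (filter P? X)

  indicator : B → ℕ
  indicator x = if does (P? x) then 1 else 0

  count-∷ : ∀ x X → count (x ∷ X) ≡ indicator x + count X
  count-∷ x X with P? x
  ... | yes _ = refl
  ... | no _ = refl

module _ {b c : Level} {B : Set b} {C : Set c} (_≟C_ : DecidableEquality C) (f : B → C) where

  fibre : C → List B → ℕ
  fibre u = count (λ y → f y ≟C u)

  private
    indicator-sum : ∀ {X : List C} y → Unique X → f y ∈ X →
      sumOver (λ u → indicator (λ y → f y ≟C u) y) X ≡ 1
    indicator-sum {X} y X! fy∈X =
      trans (sumOver-single _ X! fy∈X off-fy) (on-fy (f y) refl)
      where
      off-fy : ∀ {u} → u ∈ X → u ≢ f y → indicator (λ y → f y ≟C u) y ≡ 0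
      off-fy {u} _ u≢fy with f y ≟C u
      ... | yes fy≡u = ⊥-elim (u≢fy (sym fy≡u))
      ... | no _ = refl
      on-fy : ∀ v → v ≡ f y → indicator (λ y → f y ≟C v) y ≡ 1
      on-fy v v≡fy with f y ≟C v
      ... | yes _ = refl
      ... | no fy≢v = ⊥-elim (fy≢v (sym v≡fy))

  length≡sum-of-fibres : ∀ (X : List C) (Y : List B) → Unique X → All (λ y → f y ∈ X) Y →
    length Y ≡ sumOver (λ u → fibre u Y) X
  length≡sum-of-fibres X [] _ _ = sym (sumOver-zero _ X (λ _ → refl))
  length≡sum-of-fibres X (y ∷ Y) X! (fy∈X ∷ fY⊆X) = begin
    1 + length Y
      ≡⟨ cong₂ _+_ (sym (indicator-sum y X! fy∈X)) (length≡sum-of-fibres X Y X! fY⊆X) ⟩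
    sumOver (λ u → indicator (λ y → f y ≟C u) y) X + sumOver (λ u → fibre u Y) X
      ≡⟨ sym (sumOver-+ _ _ X) ⟩
    sumOver (λ u → indicator (λ y → f y ≟C u) y + fibre u Y) X
      ≡⟨ sumOver-cong _ _ X (λ {u} _ → sym (count-∷ (λ y → f y ≟C u) y Y)) ⟩
    sumOver (λ u → fibre u (y ∷ Y)) X ∎
    where open ≡-Reasoning

-- Σ g + #{g = 0} = |X| + Σ (g - 1): each entry contributes g x + [g x = 0],
-- which is 1 + (g x - 1).
sumOver+zeros : ∀ {b} {B : Set b} (g : B → ℕ) (X : List B) →
  sumOver g X + count (λ u → g u ≟ℕ 0) X ≡ length X + sumOver (λ u → g u ∸ 1) X
sumOver+zeros g [] = refl
sumOver+zeros g (x ∷ X) = begin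
  g x + sumOver g X + count isZero (x ∷ X)
    ≡⟨ cong (g x + sumOver g X +_) (count-∷ isZero x X) ⟩
  g x + sumOver g X + (indicator isZero x + count isZero X)
    ≡⟨ interchange (g x) _ _ _ ⟩
  (g x + indicator isZero x) + (sumOver g X + count isZero X)
    ≡⟨ cong₂ _+_ (entry (g x)) (sumOver+zeros g X) ⟩
  suc (g x ∸ 1) + (length X + sumOver (λ u → g u ∸ 1) X)
    ≡⟨ cong suc (x∙yz≈y∙xz (g x ∸ 1) (length X) _) ⟩
  suc (length X + (g x ∸ 1 + sumOver (λ u → g u ∸ 1) X)) ∎
  where
  open ≡-Reasoning
  isZero = λ u → g u ≟ℕ 0
  entry : ∀ m → m + indicator (_≟ℕ 0) m ≡ suc (m ∸ 1)
  entry zero = refl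
  entry (suc m) = +-identityʳ (suc m)

sumTo : (ℕ → ℕ) → ℕ → ℕ
sumTo f zero = 0
sumTo f (suc m) = sumTo f m + f m

telescope : ∀ (g c s : ℕ → ℕ) → (∀ ℓ → g (suc ℓ) + c ℓ ≡ g ℓ + s ℓ) →
  ∀ m → g m + sumTo c m ≡ g 0 + sumTo s m
telescope g c s step zero = refl
telescope g c s step (suc m) = begin
  g (suc m) + (sumTo c m + c m) ≡⟨ x∙yz≈xz∙y (g (suc m)) _ (c m) ⟩
  g (suc m) + c m + sumTo c m   ≡⟨ cong (_+ sumTo c m) (step m) ⟩
  g m + s m + sumTo c m         ≡⟨ xy∙z≈xz∙y (g m) (s m) _ ⟩
  g m + sumTo c m + s m         ≡⟨ cong (_+ s m) (telescope g c s step m) ⟩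
  g 0 + sumTo s m + s m         ≡⟨ +-assoc (g 0) _ (s m) ⟩
  g 0 + (sumTo s m + s m)       ∎
  where open ≡-Reasoning

sumTo-suc : ∀ (f : ℕ → ℕ) K → sumTo f (suc K) ≡ f 0 + sumTo (λ i → f (suc i)) K
sumTo-suc f zero = +-comm 0 (f 0)
sumTo-suc f (suc K) = trans (cong (_+ f (suc K)) (sumTo-suc f K)) (+-assoc (f 0) _ (f (suc K)))

sumTo-vanishing-tail : ∀ (f : ℕ → ℕ) L → (∀ ℓ → L ≤ ℓ → f ℓ ≡ 0) →
  ∀ m → L ≤ m → sumTo f m ≡ sumTo f L
sumTo-vanishing-tail f L vanish m L≤m = trans (cong (sumTo f) (sym (m∸n+n≡m L≤m))) (drop (m ∸ L))
  where
  drop : ∀ k → sumTo f (k + L) ≡ sumTo f L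
  drop zero = refl
  drop (suc k) = trans (cong (sumTo f (k + L) +_) (vanish (k + L) (m≤n+m L k)))
                       (trans (+-identityʳ _) (drop k))

sumTo-step-function : ∀ (c : ℕ → ℕ) H m →
  (∀ ℓ → ℓ < H → c ℓ ≡ 0) → (∀ ℓ → H ≤ ℓ → ℓ < m → c ℓ ≡ 1) → sumTo c m ≡ m ∸ H
sumTo-step-function c H zero _ _ = sym (0∸n≡0 H)
sumTo-step-function c H (suc m) below above with H ≤? m
... | yes H≤m = begin
  sumTo c m + c m ≡⟨ cong₂ _+_ ih (above m H≤m ≤-refl) ⟩
  m ∸ H + 1       ≡⟨ sym (+-∸-comm 1 H≤m) ⟩
  m + 1 ∸ H       ≡⟨ cong (_∸ H) (+-comm m 1) ⟩
  suc m ∸ H       ∎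
  where
  open ≡-Reasoning
  ih = sumTo-step-function c H m below (λ ℓ H≤ℓ ℓ<m → above ℓ H≤ℓ (m<n⇒m<1+n ℓ<m))
... | no H≰m = begin
  sumTo c m + c m ≡⟨ cong₂ _+_ ih (below m m<H) ⟩
  m ∸ H + 0       ≡⟨ cong (_+ 0) (m≤n⇒m∸n≡0 (<⇒≤ m<H)) ⟩
  0               ≡⟨ sym (m≤n⇒m∸n≡0 m<H) ⟩
  suc m ∸ H       ∎
  where
  open ≡-Reasoning
  m<H = ≰⇒> H≰m
  ih = sumTo-step-function c H m below (λ ℓ H≤ℓ ℓ<m → above ℓ H≤ℓ (m<n⇒m<1+n ℓ<m))

restrict : ∀ {p} {P : ℕ → Set p} {K} → (∀ i → i < suc K → P i) → ∀ i → i < K → P i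
restrict all-below i i<K = all-below i (m<n⇒m<1+n i<K)

sumTo-positive : ∀ (f : ℕ → ℕ) K → (∀ i → i < K → 1 ≤ f i) → K ≤ sumTo f K
sumTo-positive f zero _ = z≤n
sumTo-positive f (suc K) pos = subst (_≤ sumTo f K + f K) (+-comm K 1)
  (+-mono-≤ (sumTo-positive f K (restrict pos)) (pos K ≤-refl))

sumTo≡length⇔all-one : ∀ (f : ℕ → ℕ) K → (∀ i → i < K → 1 ≤ f i) →
  (sumTo f K ≡ K) ⇔ (∀ i → i < K → f i ≡ 1)
sumTo≡length⇔all-one f K pos = mk⇔ (all-one K pos) (sum-ones K)
  where
  tight : ∀ {a b} K → a + b ≡ K + 1 → K ≤ a → 1 ≤ b → a ≡ K × b ≡ 1
  tight {a} {b} K a+b≡K+1 K≤a 1≤b = a≡K , +-cancelˡ-≡ K b 1 (subst (λ t → t + b ≡ K + 1) a≡K a+b≡K+1)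
    where
    a≡K : a ≡ K
    a≡K = ≤-antisym (+-cancelʳ-≤ 1 a K (≤-trans (+-monoʳ-≤ a 1≤b) (≤-reflexive a+b≡K+1))) K≤a
  all-one : ∀ K → (∀ i → i < K → 1 ≤ f i) → sumTo f K ≡ K → ∀ i → i < K → f i ≡ 1
  all-one (suc K) pos sum≡ i i<1+K
    with tight K (trans sum≡ (+-comm 1 K)) (sumTo-positive f K (restrict pos)) (pos K ≤-refl)
  ... | sum≡K , fK≡1 with m≤n⇒m<n∨m≡n (s≤s⁻¹ i<1+K)
  ... | inj₁ i<K = all-one K (restrict pos) sum≡K i i<K
  ... | inj₂ refl = fK≡1
  sum-ones : ∀ K → (∀ i → i < K → f i ≡ 1) → sumTo f K ≡ K
  sum-ones zero _ = refl
  sum-ones (suc K) ones = trans (cong₂ _+_ (sum-ones K (restrict ones)) (ones K ≤-refl)) (+-comm K 1)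

module _ {a : Level} {A : Set a} where

  length≡0 : ∀ {xs : List A} → length xs ≡ 0 → xs ≡ []
  length≡0 {[]} _ = refl

  prefix-by-length : ∀ {u v s t : List A} → u ++ s ≡ v ++ t → length u ≡ length v → u ≡ v
  prefix-by-length {[]} {[]} _ _ = refl
  prefix-by-length {x ∷ u} {y ∷ v} eq len-eq with ∷-injective eq
  ... | refl , eq′ = cong (x ∷_) (prefix-by-length eq′ (suc-injective len-eq))

  prefix-of-prefix : ∀ {u v s t : List A} → u ++ s ≡ v ++ t → length u ≤ length v → ∃[ r ] (v ≡ u ++ r)
  prefix-of-prefix {[]} {v} _ _ = v , refl
  prefix-of-prefix {x ∷ u} {y ∷ v} eq (s≤s u≤v) with ∷-injective eq
  ... | refl , eq′ with prefix-of-prefix eq′ u≤v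
  ... | r , v≡ur = r , cong (x ∷_) v≡ur

  cut-at : ∀ k (v : List A) → k ≤ length v → ∃[ p ] ∃[ t ] (v ≡ p ++ t × length p ≡ k)
  cut-at zero v _ = [] , v , refl , refl
  cut-at (suc k) (x ∷ v) (s≤s k≤v) with cut-at k v k≤v
  ... | p , t , v≡pt , |p|≡k = x ∷ p , t , cong (x ∷_) v≡pt , cong suc |p|≡k

  length-factorisation : ∀ {w p u s : List A} → w ≡ p ++ u ++ s →
    length p + length s + length u ≡ length w
  length-factorisation {w} {p} {u} {s} refl = begin
    length p + length s + length u   ≡⟨ sym (x∙yz≈xz∙y (length p) (length u) (length s)) ⟩
    length p + (length u + length s) ≡⟨ cong (length p +_) (sym (length-++ u)) ⟩
    length p + length (u ++ s)       ≡⟨ sym (length-++ p) ⟩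
    length (p ++ u ++ s)             ∎
    where open ≡-Reasoning

  factor-length : ∀ {u w : List A} → Factor u w → length u ≤ length w
  factor-length {u} (p , s , w≡pus) =
    subst (length u ≤_) (length-factorisation {p = p} {u} {s} w≡pus) (m≤n+m (length u) (length p + length s))

  factor-of-full-length : ∀ {w p u s : List A} → w ≡ p ++ u ++ s → length u ≡ length w → p ≡ [] × s ≡ []
  factor-of-full-length {w} {p} {u} {s} w≡pus |u|≡|w| =
    length≡0 (m+n≡0⇒m≡0 (length p) no-room) , length≡0 (m+n≡0⇒n≡0 (length p) no-room)
    where
    no-room : length p + length s ≡ 0
    no-room = +-cancelʳ-≡ (length w) _ 0
      (trans (cong (length p + length s +_) (sym |u|≡|w|)) (length-factorisation {w} {p} {u} {s} w≡pus))

  factor-tail : ∀ {x} {u w : List A} → Factor (x ∷ u) w → Factor u w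
  factor-tail {x} {u} (p , s , w≡pxus) = p ++ x ∷ [] , s , trans w≡pxus (sym (++-assoc p (x ∷ []) (u ++ s)))

  factor-prefix : ∀ {v t w : List A} → Factor (v ++ t) w → Factor v w
  factor-prefix {v} {t} (p , s , w≡pvts) = p , t ++ s , trans w≡pvts (cong (p ++_) (++-assoc v t s))

  prefixes : List A → List (List A)
  prefixes [] = [] ∷ []
  prefixes (x ∷ xs) = [] ∷ map (x ∷_) (prefixes xs)

  prefixes-sound : ∀ v {u} → u ∈ prefixes v → Prefix u v
  prefixes-sound [] (here refl) = [] , refl
  prefixes-sound (x ∷ xs) (here refl) = x ∷ xs , refl
  prefixes-sound (x ∷ xs) (there u∈) with ∈-map⁻ (x ∷_) u∈
  ... | u′ , u′∈ , refl with prefixes-sound xs u′∈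
  ... | s , xs≡u′s = s , cong (x ∷_) xs≡u′s

  prefixes-complete : ∀ u s → u ∈ prefixes (u ++ s)
  prefixes-complete [] [] = here refl
  prefixes-complete [] (_ ∷ _) = here refl
  prefixes-complete (x ∷ u) s = there (∈-map⁺ (x ∷_) (prefixes-complete u s))

  factors : List A → List (List A)
  factors [] = [] ∷ []
  factors (x ∷ xs) = prefixes (x ∷ xs) ++ factors xs

  factors-sound : ∀ v {u} → u ∈ factors v → Factor u v
  factors-sound [] (here refl) = [] , [] , refl
  factors-sound (x ∷ xs) u∈ with ∈-++⁻ (prefixes (x ∷ xs)) u∈
  ... | inj₁ u∈prefixes with prefixes-sound (x ∷ xs) u∈prefixes
  ...   | s , eq = [] , s , eq
  factors-sound (x ∷ xs) u∈ | inj₂ u∈factors with factors-sound xs u∈factors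
  ...   | p , s , eq = x ∷ p , s , cong (x ∷_) eq

  factors-complete : ∀ {u w} → Factor u w → u ∈ factors w
  factors-complete {u} (p , s , refl) = go p u s
    where
    go : ∀ p u s → u ∈ factors (p ++ u ++ s)
    go [] [] [] = here refl
    go [] [] (y ∷ s) = ∈-++⁺ˡ {xs = prefixes (y ∷ s)} (here refl)
    go [] (x ∷ u) s = ∈-++⁺ˡ (prefixes-complete (x ∷ u) s)
    go (y ∷ p) u s = ∈-++⁺ʳ (prefixes (y ∷ p ++ u ++ s)) (go p u s)

  factor? : DecidableEquality A → ∀ u w → Dec (Factor u w)
  factor? _≟_ u w = map′ (factors-sound w) factors-complete (DecMembership._∈?_ (≡-dec _≟_) u (factors w))

module Factors {a : Level} {A : Set a} (_≟_ : DecidableEquality A) (w : List A) where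

  _≟ʷ_ : DecidableEquality (List A)
  _≟ʷ_ = ≡-dec _≟_

  factorsOfLength : ℕ → List (List A)
  factorsOfLength ℓ = deduplicate _≟ʷ_ (filter (λ u → length u ≟ℕ ℓ) (factors w))

  factorsOfLength-unique : ∀ ℓ → Unique (factorsOfLength ℓ)
  factorsOfLength-unique ℓ = UniqueDec.deduplicate-! _≟ʷ_ _

  factorsOfLength⁺ : ∀ {u ℓ} → Factor u w → length u ≡ ℓ → u ∈ factorsOfLength ℓ
  factorsOfLength⁺ u∈w |u|≡ℓ =
    ∈-deduplicate⁺ _≟ʷ_ (∈-filter⁺ (λ u → length u ≟ℕ _) (factors-complete u∈w) |u|≡ℓ)

  factorsOfLength⁻ : ∀ {u ℓ} → u ∈ factorsOfLength ℓ → Factor u w × length u ≡ ℓ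
  factorsOfLength⁻ u∈ with ∈-filter⁻ (λ u → length u ≟ℕ _) (∈-deduplicate⁻ _≟ʷ_ _ u∈)
  ... | u∈factors , |u|≡ℓ = factors-sound w u∈factors , |u|≡ℓ

  F : ℕ → ℕ
  F ℓ = length (factorsOfLength ℓ)

  alphabet : List A
  alphabet = deduplicate _≟_ w

  extensions : List A → List A
  extensions u = filter (λ x → factor? _≟_ (x ∷ u) w) alphabet

  valence : List A → ℕ
  valence u = length (extensions u)

  extensions-unique : ∀ u → Unique (extensions u)
  extensions-unique u = Unique.filter⁺ (λ x → factor? _≟_ (x ∷ u) w) (UniqueDec.deduplicate-! _≟_ w)

  extensions⁺ : ∀ {x u} → Factor (x ∷ u) w → x ∈ extensions u
  extensions⁺ {x} {u} xu∈w@(p , s , w≡pxus) =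
    ∈-filter⁺ (λ x → factor? _≟_ (x ∷ u) w)
      (∈-deduplicate⁺ _≟_ (subst (x ∈_) (sym w≡pxus) (∈-++⁺ʳ p (here refl)))) xu∈w

  extensions⁻ : ∀ {x u} → x ∈ extensions u → Factor (x ∷ u) w
  extensions⁻ {x} {u} x∈ = proj₂ (∈-filter⁻ (λ x → factor? _≟_ (x ∷ u) w) {xs = alphabet} x∈)

  valence-is-leftValence : ∀ {u} → Factor u w → LeftValence w u (valence u)
  valence-is-leftValence {u} u∈w =
    u∈w , extensions u , extensions-unique u , (λ x → mk⇔ extensions⁻ extensions⁺) , refl

  leftValence-unique : ∀ {u j} → LeftValence w u j → j ≡ valence u
  leftValence-unique {u} (_ , xs , xs! , xs⇔ , refl) =
    ≤-antisym (unique-⊆⇒length-≤ xs! (λ x∈ → extensions⁺ (Equivalence.to (xs⇔ _) x∈)))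
              (unique-⊆⇒length-≤ (extensions-unique u) (λ x∈ → Equivalence.from (xs⇔ _) (extensions⁻ x∈)))

  leftSpecial⇒ : ∀ {u} → LeftSpecial w u → Factor u w × 2 ≤ valence u
  leftSpecial⇒ (j , lv , 2≤j) = proj₁ lv , subst (2 ≤_) (leftValence-unique lv) 2≤j

  leftSpecial⇐ : ∀ {u} → Factor u w → 2 ≤ valence u → LeftSpecial w u
  leftSpecial⇐ u∈w 2≤val = _ , valence-is-leftValence u∈w , 2≤val

  -- Every letter of w extends the empty factor.
  valence-[] : valence [] ≡ alphSize _≟_ w
  valence-[] = cong length (filter-all (λ x → factor? _≟_ (x ∷ []) w) (All.tabulate letter-factor))
    where
    letter-factor : ∀ {x} → x ∈ alphabet → Factor (x ∷ []) w
    letter-factor x∈ with ∈-∃++ (∈-deduplicate⁻ _≟_ w x∈)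
    ... | p , s , w≡pxs = p , s , w≡pxs

  valence-antitone : ∀ {v t} → valence (v ++ t) ≤ valence v
  valence-antitone {v} {t} = unique-⊆⇒length-≤ (extensions-unique (v ++ t))
    (λ {x} x∈ → extensions⁺ (factor-prefix {v = x ∷ v} {t = t} (extensions⁻ x∈)))

  -- F (ℓ+1) = Σ_{|u| = ℓ} valence u: a factor of length ℓ+1 is x u for a
  -- unique factor u of length ℓ, and u has exactly valence u such x.
  F-suc : ∀ ℓ → F (suc ℓ) ≡ sumOver valence (factorsOfLength ℓ)
  F-suc ℓ = trans (length≡sum-of-fibres _≟ʷ_ tail (factorsOfLength ℓ) (factorsOfLength (suc ℓ))
                     (factorsOfLength-unique ℓ) (All.tabulate tail∈))
                  (sumOver-cong _ _ (factorsOfLength ℓ) fibre≡valence)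
    where
    tail : List A → List A
    tail [] = []
    tail (_ ∷ xs) = xs

    tail∈ : ∀ {y} → y ∈ factorsOfLength (suc ℓ) → tail y ∈ factorsOfLength ℓ
    tail∈ {y} y∈ with factorsOfLength⁻ {ℓ = suc ℓ} y∈
    tail∈ {x ∷ y} y∈ | xy∈w , |xy|≡ = factorsOfLength⁺ (factor-tail xy∈w) (suc-injective |xy|≡)

    -- The fibre of tail over u is the list of words x u with x ∈ extensions u.
    fibre≡valence : ∀ {u} → u ∈ factorsOfLength ℓ → fibre _≟ʷ_ tail u (factorsOfLength (suc ℓ)) ≡ valence u
    fibre≡valence {u} u∈ = ≤-antisym
      (subst (length fibreList ≤_) (length-map (_∷ u) (extensions u))
        (unique-⊆⇒length-≤ (Unique.filter⁺ (λ y → tail y ≟ʷ u) (factorsOfLength-unique (suc ℓ))) fibre⊆))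
      (subst (_≤ length fibreList) (length-map (_∷ u) (extensions u))
        (unique-⊆⇒length-≤ (Unique.map⁺ (λ eq → proj₁ (∷-injective eq)) (extensions-unique u)) ⊆fibre))
      where
      fibreList = filter (λ y → tail y ≟ʷ u) (factorsOfLength (suc ℓ))
      fibre⊆ : fibreList ⊆ map (_∷ u) (extensions u)
      fibre⊆ {y} y∈ with ∈-filter⁻ (λ y → tail y ≟ʷ u) {xs = factorsOfLength (suc ℓ)} y∈
      fibre⊆ {x ∷ y} _ | xy∈ , refl = ∈-map⁺ (_∷ u) (extensions⁺ (proj₁ (factorsOfLength⁻ xy∈)))
      fibre⊆ {[]} _ | []∈ , _ with proj₂ (factorsOfLength⁻ {ℓ = suc ℓ} []∈)
      ... | ()
      ⊆fibre : map (_∷ u) (extensions u) ⊆ fibreList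
      ⊆fibre y∈ with ∈-map⁻ (_∷ u) y∈
      ... | x , x∈ , refl = ∈-filter⁺ (λ y → tail y ≟ʷ u)
        (factorsOfLength⁺ (extensions⁻ x∈) (cong suc (proj₂ (factorsOfLength⁻ u∈)))) refl

  F-0 : F 0 ≡ 1
  F-0 = unique-constant⇒length≡1 (factorsOfLength-unique 0) (factorsOfLength⁺ ([] , w , refl) refl)
          (λ u∈ → length≡0 (proj₂ (factorsOfLength⁻ u∈)))

  F-length : F (length w) ≡ 1
  F-length = unique-constant⇒length≡1 (factorsOfLength-unique (length w))
    (factorsOfLength⁺ ([] , [] , sym (++-identityʳ w)) refl) whole
    where
    whole : ∀ {u} → u ∈ factorsOfLength (length w) → u ≡ w
    whole u∈ with factorsOfLength⁻ u∈
    ... | (p , s , w≡pus) , |u|≡|w| with factor-of-full-length {p = p} {s = s} w≡pus |u|≡|w|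
    ... | refl , refl = sym (trans w≡pus (++-identityʳ _))

  -- A dead end is a factor without left extension.  It can only occur at
  -- position 0, so it is a prefix occurring exactly once, and conversely.
  deadEnd-no-extension : ∀ {u x} → valence u ≡ 0 → ¬ Factor (x ∷ u) w
  deadEnd-no-extension val≡0 xu∈w = 1+n≰n (subst (1 ≤_) val≡0 (member⇒length≥1 (extensions⁺ xu∈w)))

  deadEnd-at-start : ∀ {u p s} → valence u ≡ 0 → w ≡ p ++ u ++ s → p ≡ []
  deadEnd-at-start {u} {p} {s} val≡0 w≡pus with initLast p
  ... | [] = refl
  ... | p′ ∷ʳ′ x = ⊥-elim (deadEnd-no-extension val≡0 (p′ , s , trans w≡pus (++-assoc p′ (x ∷ []) (u ++ s))))

  deadEnd⇒unique-prefix : ∀ {u} → Factor u w → valence u ≡ 0 → Prefix u w × OccursOnce u w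
  deadEnd⇒unique-prefix {u} (p , s , w≡pus) val≡0 with deadEnd-at-start {p = p} val≡0 w≡pus
  ... | refl = (s , w≡pus) , 0 , ([] , s , w≡pus , refl) , only-at-0
    where
    only-at-0 : ∀ j → OccursAt u w j → j ≡ 0
    only-at-0 j (p′ , s′ , w≡p′us′ , |p′|≡j) =
      trans (sym |p′|≡j) (cong length (deadEnd-at-start {p = p′} val≡0 w≡p′us′))

  -- If x u were a factor, u would also occur at a position i + 1 > 0.
  unique-prefix⇒deadEnd : ∀ {u} → Prefix u w → OccursOnce u w → valence u ≡ 0
  unique-prefix⇒deadEnd {u} (s₀ , w≡us₀) (i , _ , only-at-i) =
    no-member⇒length≡0 (extensions u) (λ x∈ → second-occurrence (extensions⁻ x∈))
    where
    second-occurrence : ∀ {x} → ¬ Factor (x ∷ u) w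
    second-occurrence {x} (q , s , w≡qxus) = 1+n≢0 (trans (sym (length-++-sucʳ q x [])) (trans at-i (sym at-0)))
      where
      at-i = only-at-i (length (q ∷ʳ x)) (q ∷ʳ x , s , trans w≡qxus (sym (++-assoc q (x ∷ []) (u ++ s))) , refl)
      at-0 = only-at-i 0 ([] , s₀ , w≡us₀ , refl)

  deadEnds : ℕ → ℕ
  deadEnds ℓ = count (λ u → valence u ≟ℕ 0) (factorsOfLength ℓ)

  deadEnd⁻ : ∀ {u ℓ} → u ∈ filter (λ u → valence u ≟ℕ 0) (factorsOfLength ℓ) →
    Prefix u w × OccursOnce u w × length u ≡ ℓ
  deadEnd⁻ u∈ with ∈-filter⁻ (λ u → valence u ≟ℕ 0) {xs = factorsOfLength _} u∈
  ... | u∈factors , val≡0 with factorsOfLength⁻ u∈factors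
  ... | u∈w , |u|≡ℓ with deadEnd⇒unique-prefix u∈w val≡0
  ... | prefix , once = prefix , once , |u|≡ℓ

  -- Two dead ends of the same length are prefixes of the same length.
  deadEnds-≤1 : ∀ ℓ → deadEnds ℓ ≤ 1
  deadEnds-≤1 ℓ = unique-constant⇒length≤1
    (Unique.filter⁺ (λ u → valence u ≟ℕ 0) (factorsOfLength-unique ℓ)) same-prefix
    where
    same-prefix : ∀ {u v} → _ → _ → u ≡ v
    same-prefix u∈ v∈ with deadEnd⁻ u∈ | deadEnd⁻ v∈
    ... | (s , w≡us) , _ , |u|≡ℓ | (t , w≡vt) , _ , |v|≡ℓ =
      prefix-by-length (trans (sym w≡us) w≡vt) (trans |u|≡ℓ (sym |v|≡ℓ))

  -- Beyond a prefix u₀ occurring once, the prefix of each length ℓ ≤ |w|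
  -- extends u₀, hence is a dead end along with u₀, and the only one.
  deadEnds-beyond-unique-prefix : ∀ {u₀ ℓ} → Prefix u₀ w → OccursOnce u₀ w →
    length u₀ ≤ ℓ → ℓ ≤ length w → deadEnds ℓ ≡ 1
  deadEnds-beyond-unique-prefix {u₀} {ℓ} (s₀ , w≡u₀s₀) once |u₀|≤ℓ ℓ≤|w| with cut-at ℓ w ℓ≤|w|
  ... | p , t , w≡pt , |p|≡ℓ
    with prefix-of-prefix {u = u₀} {v = p} (trans (sym w≡u₀s₀) w≡pt) (subst (length u₀ ≤_) (sym |p|≡ℓ) |u₀|≤ℓ)
  ... | r , refl = ≤-antisym (deadEnds-≤1 ℓ)
    (member⇒length≥1 (∈-filter⁺ (λ u → valence u ≟ℕ 0) (factorsOfLength⁺ ([] , t , w≡pt) |p|≡ℓ) p-deadEnd))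
    where
    p-deadEnd : valence (u₀ ++ r) ≡ 0
    p-deadEnd = n≤0⇒n≡0 (subst (valence (u₀ ++ r) ≤_) (unique-prefix⇒deadEnd (s₀ , w≡u₀s₀) once)
                          (valence-antitone {u₀} {r}))

  module _ {H : ℕ} (isH : IsH w H) where

    deadEnds-below-H : ∀ ℓ → ℓ < H → deadEnds ℓ ≡ 0
    deadEnds-below-H ℓ ℓ<H = no-member⇒length≡0 _ λ u∈ → too-short (deadEnd⁻ u∈)
      where
      too-short : ∀ {u} → Prefix u w × OccursOnce u w × length u ≡ ℓ → ⊥
      too-short (prefix , once , |u|≡ℓ) = <⇒≱ ℓ<H (subst (H ≤_) |u|≡ℓ (proj₂ (proj₂ isH) _ prefix once))

    deadEnds-from-H : ∀ ℓ → H ≤ ℓ → ℓ ≤ length w → deadEnds ℓ ≡ 1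
    deadEnds-from-H ℓ H≤ℓ = deadEnds-beyond-unique-prefix prefix once (subst (_≤ ℓ) (sym |u₀|≡H) H≤ℓ)
      where
      u₀ = proj₁ isH
      prefix = proj₁ (proj₁ (proj₂ isH))
      |u₀|≡H = proj₁ (proj₂ (proj₁ (proj₂ isH)))
      once = proj₂ (proj₂ (proj₁ (proj₂ isH)))

    H≤length : H ≤ length w
    H≤length = proj₂ (proj₂ isH) w ([] , sym (++-identityʳ w)) (0 , ([] , [] , sym (++-identityʳ w) , refl) , only-at-0)
      where
      only-at-0 : ∀ j → OccursAt w w j → j ≡ 0
      only-at-0 j (p , s , w≡pws , |p|≡j) =
        trans (sym |p|≡j) (cong length (proj₁ (factor-of-full-length {p = p} {s = s} w≡pws refl)))

    deadEnds-total : sumTo deadEnds (length w) ≡ length w ∸ H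
    deadEnds-total = sumTo-step-function deadEnds H (length w) deadEnds-below-H
      (λ ℓ H≤ℓ ℓ<|w| → deadEnds-from-H ℓ H≤ℓ (<⇒≤ ℓ<|w|))

  excess : ℕ → ℕ
  excess ℓ = sumOver (λ u → valence u ∸ 1) (factorsOfLength ℓ)

  excess-≥-member : ∀ {u} → Factor u w → valence u ∸ 1 ≤ excess (length u)
  excess-≥-member u∈w = sumOver-≥-member (λ u → valence u ∸ 1) (factorsOfLength⁺ u∈w refl)

  balance : ∀ ℓ → F (suc ℓ) + deadEnds ℓ ≡ F ℓ + excess ℓ
  balance ℓ = trans (cong (_+ deadEnds ℓ) (F-suc ℓ)) (sumOver+zeros valence (factorsOfLength ℓ))

  -- Telescoping the balance from 0 to |w|, where F 0 = F |w| = 1.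
  excess-total : ∀ {H} → IsH w H → sumTo excess (length w) ≡ length w ∸ H
  excess-total {H} isH = suc-injective (begin
    1 + sumTo excess (length w)
      ≡⟨ cong (_+ sumTo excess (length w)) (sym F-0) ⟩
    F 0 + sumTo excess (length w)
      ≡⟨ sym (telescope F deadEnds excess balance (length w)) ⟩
    F (length w) + sumTo deadEnds (length w)
      ≡⟨ cong₂ _+_ F-length (deadEnds-total isH) ⟩
    1 + (length w ∸ H) ∎)
    where open ≡-Reasoning

  excess-0 : excess 0 ≡ alphSize _≟_ w ∸ 1
  excess-0 = trans (sumOver-single (λ u → valence u ∸ 1) (factorsOfLength-unique 0)
                     (factorsOfLength⁺ ([] , w , refl) refl) only-[])
                   (cong (_∸ 1) valence-[])
    where
    only-[] : ∀ {u} → u ∈ factorsOfLength 0 → u ≢ [] → valence u ∸ 1 ≡ 0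
    only-[] u∈ u≢[] = ⊥-elim (u≢[] (length≡0 (proj₂ (factorsOfLength⁻ u∈))))

  leftSpecial-[] : 2 ≤ alphSize _≟_ w → LeftSpecial w []
  leftSpecial-[] d≥2 = leftSpecial⇐ ([] , w , refl) (subst (2 ≤_) (sym valence-[]) d≥2)

  excess≡1⇔ : ∀ {u ℓ} → LeftSpecial w u → length u ≡ ℓ → (excess ℓ ≡ 1) ⇔
    (UniqueLSOfLength w ℓ × (∀ v → LeftSpecial w v → length v ≡ ℓ → valence v ≡ 2))
  excess≡1⇔ {u} u-special refl = mk⇔ (λ excess≡1 → (u , u-special , refl , only-u excess≡1) , valence-2 excess≡1) from
    where
    contribution : ∀ {v} → LeftSpecial w v → valence v ∸ 1 ≤ excess (length v)
    contribution v-special = excess-≥-member (proj₁ (leftSpecial⇒ v-special))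

    only-u : excess (length u) ≡ 1 → ∀ v → LeftSpecial w v → length v ≡ length u → v ≡ u
    only-u excess≡1 v v-special |v|≡|u| with v ≟ʷ u
    ... | yes v≡u = v≡u
    ... | no v≢u = ⊥-elim (1+n≰n {1} (begin
      2                               ≤⟨ +-mono-≤ (∸-monoˡ-≤ 1 (proj₂ (leftSpecial⇒ v-special)))
                                                   (∸-monoˡ-≤ 1 (proj₂ (leftSpecial⇒ u-special))) ⟩
      valence v ∸ 1 + (valence u ∸ 1) ≤⟨ sumOver-≥-pair (λ u → valence u ∸ 1) (factorsOfLength-unique _)
                                           (factorsOfLength⁺ (proj₁ (leftSpecial⇒ v-special)) |v|≡|u|)
                                           (factorsOfLength⁺ (proj₁ (leftSpecial⇒ u-special)) refl) v≢u ⟩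
      excess (length u)               ≡⟨ excess≡1 ⟩
      1                               ∎))
      where open ≤-Reasoning

    valence-2 : excess (length u) ≡ 1 → ∀ v → LeftSpecial w v → length v ≡ length u → valence v ≡ 2
    valence-2 excess≡1 v v-special |v|≡|u| = ≤-antisym
      (m∸1≤1⇒m≤2 (valence v) (subst (valence v ∸ 1 ≤_) (trans (cong excess |v|≡|u|) excess≡1) (contribution v-special)))
      (proj₂ (leftSpecial⇒ v-special))
      where
      m∸1≤1⇒m≤2 : ∀ m → m ∸ 1 ≤ 1 → m ≤ 2
      m∸1≤1⇒m≤2 zero _ = z≤n
      m∸1≤1⇒m≤2 (suc m) m≤1 = s≤s m≤1

    from : UniqueLSOfLength w (length u) × (∀ v → LeftSpecial w v → length v ≡ length u → valence v ≡ 2) →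
      excess (length u) ≡ 1
    from ((u₀ , u₀-special , |u₀|≡ , unique) , valence-2) =
      trans (sumOver-single (λ u → valence u ∸ 1) (factorsOfLength-unique _)
               (factorsOfLength⁺ (proj₁ (leftSpecial⇒ u₀-special)) |u₀|≡) others-vanish)
            (cong (_∸ 1) (valence-2 u₀ u₀-special |u₀|≡))
      where
      others-vanish : ∀ {v} → v ∈ factorsOfLength (length u) → v ≢ u₀ → valence v ∸ 1 ≡ 0
      others-vanish {v} v∈ v≢u₀ with 2 ≤? valence v
      ... | yes 2≤val = ⊥-elim (v≢u₀ (unique v (leftSpecial⇐ (proj₁ (factorsOfLength⁻ v∈)) 2≤val)
                                               (proj₂ (factorsOfLength⁻ v∈))))
      ... | no 2≰val = m≤n⇒m∸n≡0 (≤-pred (≰⇒> 2≰val))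

  module _ {L : ℕ} (isL : IsL w L) where

    -- A factor of length ≥ L has valence ≤ 1: otherwise its prefix of
    -- length L would be left special.
    valence-from-L : ∀ {u} → Factor u w → L ≤ length u → valence u ≤ 1
    valence-from-L {u} u∈w L≤|u| with 2 ≤? valence u
    ... | no 2≰val = ≤-pred (≰⇒> 2≰val)
    ... | yes 2≤val with cut-at L u L≤|u|
    ... | v , t , refl , |v|≡L = ⊥-elim (proj₁ (proj₂ isL) v
           (leftSpecial⇐ (factor-prefix {v = v} {t = t} u∈w) (≤-trans 2≤val (valence-antitone {v} {t}))) |v|≡L)

    excess-from-L : ∀ ℓ → L ≤ ℓ → excess ℓ ≡ 0
    excess-from-L ℓ L≤ℓ = sumOver-zero _ (factorsOfLength ℓ) λ u∈ →
      m≤n⇒m∸n≡0 (valence-from-L (proj₁ (factorsOfLength⁻ u∈))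
                                (subst (L ≤_) (sym (proj₂ (factorsOfLength⁻ u∈))) L≤ℓ))

    -- There is a left special factor of every length ℓ < L (for ℓ = 0 this
    -- is ε, left special because w has two letters).
    leftSpecial-below-L : 2 ≤ alphSize _≟_ w → ∀ ℓ → ℓ < L → ∃[ u ] (LeftSpecial w u × length u ≡ ℓ)
    leftSpecial-below-L d≥2 zero _ = [] , leftSpecial-[] d≥2 , refl
    leftSpecial-below-L _ (suc ℓ) ℓ<L = proj₂ (proj₂ isL) (suc ℓ) (s≤s z≤n) ℓ<L

    excess-below-L : 2 ≤ alphSize _≟_ w → ∀ ℓ → ℓ < L → 1 ≤ excess ℓ
    excess-below-L d≥2 ℓ ℓ<L with leftSpecial-below-L d≥2 ℓ ℓ<L
    ... | u , u-special , refl = ≤-trans (∸-monoˡ-≤ 1 (proj₂ (leftSpecial⇒ u-special)))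
                                         (excess-≥-member (proj₁ (leftSpecial⇒ u-special)))

    -- A left special factor of length L - 1 extends to a factor of length L.
    L≤length : 2 ≤ alphSize _≟_ w → L ≤ length w
    L≤length d≥2 with proj₁ isL
    ... | s≤s {n = K} z≤n with leftSpecial-below-L d≥2 K ≤-refl
    ... | u , u-special , refl
      with length≥1⇒member {xs = extensions u} (≤-trans (s≤s z≤n) (proj₂ (leftSpecial⇒ u-special)))
    ... | x , x∈ = factor-length {u = x ∷ u} {w = w} (extensions⁻ x∈)

    -- Only the lengths 1 ≤ ℓ < L contribute to the excess beyond excess 0.
    length-balance : ∀ {H K} → L ≡ suc K → IsH w H → 2 ≤ alphSize _≟_ w →
      length w ∸ H ≡ alphSize _≟_ w ∸ 1 + sumTo (λ i → excess (suc i)) K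
    length-balance {H} {K} refl isH d≥2 = begin
      length w ∸ H               ≡⟨ sym (excess-total isH) ⟩
      sumTo excess (length w)    ≡⟨ sumTo-vanishing-tail excess L excess-from-L (length w) (L≤length d≥2) ⟩
      sumTo excess (suc K)       ≡⟨ sumTo-suc excess K ⟩
      excess 0 + excess-beyond-0 ≡⟨ cong (_+ excess-beyond-0) excess-0 ⟩
      alphSize _≟_ w ∸ 1 + excess-beyond-0 ∎
      where
      open ≡-Reasoning
      excess-beyond-0 = sumTo (λ i → excess (suc i)) K

    conditions⇔ : ∀ {K} → L ≡ suc K → 2 ≤ alphSize _≟_ w →
      (∀ i → i < K → excess (suc i) ≡ 1) ⇔
      ((∀ i → i < L → UniqueLSOfLength w i) × (∀ u → ¬ (u ≡ []) → LeftSpecial w u → LeftValence w u 2))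
    conditions⇔ {K} refl d≥2 = mk⇔ to from
      where
      at : ∀ i → i < K → (excess (suc i) ≡ 1) ⇔
        (UniqueLSOfLength w (suc i) × (∀ v → LeftSpecial w v → length v ≡ suc i → valence v ≡ 2))
      at i i<K with leftSpecial-below-L d≥2 (suc i) (s≤s i<K)
      ... | u , u-special , |u|≡ = excess≡1⇔ u-special |u|≡

      to : (∀ i → i < K → excess (suc i) ≡ 1) →
        (∀ i → i < L → UniqueLSOfLength w i) × (∀ u → ¬ (u ≡ []) → LeftSpecial w u → LeftValence w u 2)
      to all-one = unique-LS , valence-2
        where
        unique-LS : ∀ i → i < L → UniqueLSOfLength w i
        unique-LS zero _ = [] , leftSpecial-[] d≥2 , refl , λ v _ |v|≡0 → length≡0 |v|≡0
        unique-LS (suc i) (s≤s i<K) = proj₁ (Equivalence.to (at i i<K) (all-one i i<K))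

        -- A non-empty left special factor is shorter than L, so its
        -- valence is 2.
        valence-2 : ∀ u → ¬ (u ≡ []) → LeftSpecial w u → LeftValence w u 2
        valence-2 [] u≢[] _ = ⊥-elim (u≢[] refl)
        valence-2 (x ∷ u) _ xu-special with suc (length u) <? L
        ... | yes (s≤s |u|<K) = subst (LeftValence w (x ∷ u))
          (proj₂ (Equivalence.to (at (length u) |u|<K) (all-one _ |u|<K)) (x ∷ u) xu-special refl)
          (valence-is-leftValence (proj₁ (leftSpecial⇒ xu-special)))
        ... | no |xu|≮L = ⊥-elim (1+n≰n {1} (≤-trans (proj₂ (leftSpecial⇒ xu-special))
          (valence-from-L (proj₁ (leftSpecial⇒ xu-special)) (≮⇒≥ |xu|≮L))))

      from : (∀ i → i < L → UniqueLSOfLength w i) × (∀ u → ¬ (u ≡ []) → LeftSpecial w u → LeftValence w u 2) →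
        ∀ i → i < K → excess (suc i) ≡ 1
      from (unique-LS , valence-2) i i<K = Equivalence.from (at i i<K)
        (unique-LS (suc i) (s≤s i<K) ,
         λ v v-special |v|≡ → sym (leftValence-unique (valence-2 v (λ { refl → 0≢1+n |v|≡ }) v-special)))

length-equation⇔ : ∀ {n H d K T} → H ≤ n → 1 ≤ d → n ∸ H ≡ d ∸ 1 + T → (n + 2 ≡ suc K + H + d) ⇔ (T ≡ K)
length-equation⇔ {n} {H} {suc D} {K} {T} H≤n _ n∸H≡ = mk⇔
  (λ eq → +-cancelˡ-≡ (2 + H + D) T K (trans (sym lhs) (trans eq rhs)))
  (λ { refl → trans lhs (sym rhs) })
  where
  lhs : n + 2 ≡ 2 + H + D + T
  lhs = begin
    n + 2               ≡⟨ cong (_+ 2) (sym (m+[n∸m]≡n H≤n)) ⟩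
    H + (n ∸ H) + 2     ≡⟨ cong (λ m → H + m + 2) n∸H≡ ⟩
    H + (D + T) + 2     ≡⟨ solve 3 (λ h d t → h :+ (d :+ t) :+ con 2 := con 2 :+ h :+ d :+ t) refl H D T ⟩
    2 + H + D + T       ∎
    where open ≡-Reasoning
  rhs : suc K + H + suc D ≡ 2 + H + D + K
  rhs = solve 3 (λ h d k → con 1 :+ k :+ h :+ (con 1 :+ d) := con 2 :+ h :+ d :+ k) refl H D K

proposition2p5 : {a : Level} {A : Set a} (_≟_ : DecidableEquality A) (w : List A) (L H : ℕ) →
    2 ≤ alphSize _≟_ w → IsL w L → IsH w H →
    (length w + 2 ≡ L + H + alphSize _≟_ w) ⇔
      ((∀ i → i < L → UniqueLSOfLength w i) ×
       (∀ u → ¬ (u ≡ []) → LeftSpecial w u → LeftValence w u 2))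
proposition2p5 _≟_ w zero H _ (() , _) _
proposition2p5 _≟_ w (suc K) H d≥2 isL isH =
  ⇔-trans (length-equation⇔ (H≤length isH) (≤-trans (s≤s z≤n) d≥2) (length-balance isL refl isH d≥2))
  (⇔-trans (sumTo≡length⇔all-one (λ i → excess (suc i)) K (λ i i<K → excess-below-L isL d≥2 (suc i) (s≤s i<K)))
           (conditions⇔ isL refl d≥2))
  where open Factors _≟_ w
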